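{- Let $n\ge1$ and let $\pi$ be a permutation of $\mathbb{Z}_n=\{0,1,\dots,n-1\}$ consisting of a single $n$-cycle. Let $p=n+1$, $\varphi(i)=ip\bmod n^2$ for $i\in\mathbb{Z}_{n^2}$, and for $t,g\in\mathbb{Z}_n$ let $f(t,g)=\varphi(gn+((t-g)\bmod n))$. Define words $u'=u'_0\cdots u'_{n^2-1}$ and $v'=v'_0\cdots v'_{n^2-1}$ over $\mathbb{Z}_n$ as follows. Call the positions $f(\pi^k(0),k)$, $k\in\mathbb{Z}_n$, distinguished, and set $u'_{f(\pi^k(0),k)}=\pi^k(0)$ and $v'_{f(\pi^k(0),k)}=\pi^{k+1}(0)$. Writing $a_i=u'_{\varphi(i)}$ and $b_i=v'_{\varphi(i)}$, for $i=1,2,\dots,n^2-1$ in increasing order, if $\varphi(i)$ is not distinguished set $a_i=b_{i-1}$ and $b_i=b_{i-1}$. Then $u'$ and $v'$ are obtained from $u=0\,1\,\cdots\,(n-1)$ and $v=\pi(0)\,\pi(1)\,\cdots\,\pi(n-1)$, respectively, by a simultaneous insertion.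
   Context: Given words $w_1,w_2\in\Sigma^n$ with $w_i=a_{i,0}\cdots a_{i,n-1}$, a simultaneous insertion transforms each $w_i$ into $x_0a_{i,0}x_1a_{i,1}\cdots x_{n-1}a_{i,n-1}x_n$, where the words $x_0,\dots,x_n\in\Sigma^*$ are the same for both $i$. Note $\varphi(0)=0=f(0,0)$ is distinguished. -}

module Defs where

open import Data.Nat using (ℕ; zero; suc; _+_; _*_; _∸_; NonZero; _≟_)
open import Data.Nat.DivMod using (_%_)
open import Data.Nat.Properties using (m*n≢0)
open import Data.Fin using (Fin; toℕ; fromℕ<)
open import Data.Fin.Permutation using (Permutation′; _⟨$⟩ʳ_)
open import Data.List using (List; []; _∷_; _++_; map; upTo)
open import Data.Vec using (Vec; []; _∷_; tabulate)
open import Data.Maybe using (Maybe; just; nothing)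
open import Data.Product using (Σ; ∃; _×_)
open import Relation.Nullary using (yes; no)
open import Relation.Binary.PropositionalEquality using (_≡_)

interleave : ∀ {A : Set} {n} → Vec (List A) (suc n) → Vec A n → List A
interleave (x ∷ [])     []       = x
interleave (x ∷ y ∷ xs) (a ∷ w)  = x ++ (a ∷ interleave (y ∷ xs) w)

SimultaneousInsertion : ∀ {A : Set} {n} → Vec A n → Vec A n → List A → List A → Set
SimultaneousInsertion {A} {n} w₁ w₂ w₁' w₂' =
  Σ (Vec (List A) (suc n)) λ xs → (w₁' ≡ interleave xs w₁) × (w₂' ≡ interleave xs w₂)

_^[_]_ : ∀ {n} → Permutation′ n → ℕ → Fin n → Fin n
π ^[ zero ]  i = i
π ^[ suc k ] i = π ⟨$⟩ʳ (π ^[ k ] i)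

IsSingleCycle : ∀ {n} → Permutation′ n → Set
IsSingleCycle {n} π = ∀ (i j : Fin n) → ∃ λ k → π ^[ k ] i ≡ j

search : (ℕ → ℕ) → ℕ → ℕ → Maybe ℕ
search g target bound = go 0 bound
  where
  go : ℕ → ℕ → Maybe ℕ
  go j zero = nothing
  go j (suc r) with g j ≟ target
  ... | yes _ = just j
  ... | no  _ = go (suc j) r

0F : (n : ℕ) .{{_ : NonZero n}} → Fin n
0F (suc n) = Fin.zero
  where import Data.Fin as Fin

module Construction (n : ℕ) .{{nz : NonZero n}} (π : Permutation′ n) where

  instance
    nn≢0 : NonZero (n * n)
    nn≢0 = m*n≢0 n n

  p : ℕ
  p = n + 1

  φ : ℕ → ℕ
  φ i = (i * p) % (n * n)

  f : ℕ → ℕ → ℕ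
  f t g = φ (g * n + ((t + (n ∸ g)) % n))

  orb : ℕ → Fin n
  orb k = π ^[ k ] (0F n)

  distK : ℕ → Maybe ℕ
  distK q = search (λ k → f (toℕ (orb k)) k) q n

  b : ℕ → Fin n
  b zero with distK (φ zero)
  ... | just k  = orb (suc k)
  ... | nothing = 0F n          -- never happens: φ(0) = 0 = f(0,0)
  b (suc i) with distK (φ (suc i))
  ... | just k  = orb (suc k)
  ... | nothing = b i

  a : ℕ → Fin n
  a i with distK (φ i)
  ... | just k  = orb k
  ... | nothing = b (i ∸ 1)

  φ⁻¹ : ℕ → ℕ
  φ⁻¹ q with search φ q (n * n)
  ... | just i  = i
  ... | nothing = 0            -- never happens: φ is a bijection of ℤ_{n²}

  u′ : List (Fin n)
  u′ = map (λ q → a (φ⁻¹ q)) (upTo (n * n))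

  v′ : List (Fin n)
  v′ = map (λ q → b (φ⁻¹ q)) (upTo (n * n))

  u : Vec (Fin n) n
  u = tabulate (λ i → i)

  v : Vec (Fin n) n
  v = tabulate (λ i → π ⟨$⟩ʳ i)

{-# OPTIONS --safe #-}
-- Write positions of u′ and v′ in base n as q = t n + r (row t, column r).
-- Multiplication by p = n + 1 acts on the digits as (q, r) ↦ ((q + r) mod n, r), so φ
-- permutes ℤ_{n²} and f(t, k) = t n + ((t − k) mod n) lies in row t. As π is a single
-- n-cycle, k ↦ π^k(0) is a bijection of ℤ_n, so every row t holds exactly one
-- distinguished position, carrying the letters (t, π(t)); at every other position
-- a_i = b_{i−1} = b_i, so u′ and v′ carry the same letter there. Thus the word of
-- letter pairs of (u′, v′) is zip u v with diagonal pairs (x, x) inserted, which is a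
-- simultaneous insertion into u and v.
module Submission where

open import Defs
open import Data.Fin using (Fin; zero; suc; toℕ; fromℕ<)
open import Data.Fin.Permutation using (Permutation′; _⟨$⟩ʳ_; _⟨$⟩ˡ_; inverseˡ)
open import Data.Fin.Properties using (toℕ-injective; toℕ<n; toℕ-fromℕ<; pigeonhole; injective⇒≤)
open import Data.List using (List; []; _∷_; _++_; [_]; map; upTo; applyUpTo)
open import Data.List.Properties using (map-upTo; map-applyUpTo)
open import Data.Maybe using (Maybe; just; nothing)
open import Data.Nat using (ℕ; NonZero; zero; suc; _+_; _*_; _∸_; _≤_; _<_; _≟_; s≤s; z<s; s<s; s≤s⁻¹; >-nonZero)
open import Data.Nat.DivMod
open import Data.Nat.Properties
open import Data.Nat.Tactic.RingSolver using (solve-∀)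
open import Data.Product using (_×_; _,_; proj₁; proj₂; ∃)
open import Data.Vec using (Vec; []; _∷_; tabulate; zip; toList)
open import Function using (_∘_)
open import Function.Definitions using (Injective)
open import Relation.Binary.Definitions using (tri<; tri≈; tri>)
open import Relation.Binary.PropositionalEquality
  using (_≡_; _≢_; _≗_; refl; sym; trans; cong; cong₂; subst; subst₂; module ≡-Reasoning)
open import Relation.Nullary using (Dec; yes; no; contradiction)

module _ (g : ℕ → ℕ) (target : ℕ) where

  -- `search` runs a loop local to an anonymous `where` block, which cannot be named.
  -- Unification against one unfolding of `search` solves `searchLoop` as that loop
  -- (as a function of the outcome of its first test), so it can be reasoned about.
  mutual
    searchLoop : (bound j r : ℕ) → Dec (g j ≡ target) → Maybe ℕ
    searchLoop = _

    search-suc : ∀ r → search g target (suc r) ≡ searchLoop (suc r) 0 r (g 0 ≟ target)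
    search-suc r with 0 | suc r
    ... | j | bound with g j ≟ target
    ... | d = refl

  searchLoop-sound : ∀ bound j r d {i} → searchLoop bound j r d ≡ just i → g i ≡ target × i < suc r + j
  searchLoop-sound bound j r (yes gj≡target) refl = gj≡target , s≤s (m≤n+m j r)
  searchLoop-sound bound j (suc r) (no _) {i} found
    with gi≡target , i< ← searchLoop-sound bound (suc j) r (g (suc j) ≟ target) found
    = gi≡target , subst (i <_) (+-suc (suc r) j) i<

  searchLoop-complete : ∀ bound j r d → searchLoop bound j r d ≡ nothing → ∀ e → e ≤ r → g (e + j) ≢ target
  searchLoop-complete bound j r (no gj≢target) _ zero _ = gj≢target
  searchLoop-complete bound j (suc r) (no _) none (suc e) (s≤s e≤r) =
    subst (λ i → g i ≢ target) (+-suc e j) (searchLoop-complete bound (suc j) r (g (suc j) ≟ target) none e e≤r)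

  search-sound : ∀ bound {i} → search g target bound ≡ just i → g i ≡ target × i < bound
  search-sound (suc r) {i} found
    with gi≡target , i< ← searchLoop-sound (suc r) 0 r (g 0 ≟ target) (trans (sym (search-suc r)) found)
    = gi≡target , subst (i <_) (+-identityʳ (suc r)) i<

  search-complete : ∀ bound → search g target bound ≡ nothing → ∀ i → i < bound → g i ≢ target
  search-complete (suc r) none i (s≤s i≤r) =
    subst (λ i → g i ≢ target) (+-identityʳ i)
      (searchLoop-complete (suc r) 0 r (g 0 ≟ target) (trans (sym (search-suc r)) none) i i≤r)

digits-< : ∀ {n q r} → q < n → r < n → q * n + r < n * n
digits-< {n} {q} {r} q<n r<n = begin-strict
  q * n + r  <⟨ +-monoʳ-< (q * n) r<n ⟩
  q * n + n  ≡⟨ +-comm (q * n) n ⟩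
  suc q * n  ≤⟨ *-monoˡ-≤ n q<n ⟩
  n * n      ∎
  where open ≤-Reasoning

digits-injective : ∀ {n q r q′ r′} .{{_ : NonZero n}} → r < n → r′ < n →
                   q * n + r ≡ q′ * n + r′ → q ≡ q′ × r ≡ r′
digits-injective {n} {q} {r} {q′} {r′} r<n r′<n eq = q≡q′ , r≡r′
  where
  open ≡-Reasoning
  r≡r′ : r ≡ r′
  r≡r′ = begin
    r                  ≡⟨ m<n⇒m%n≡m r<n ⟨
    r % n              ≡⟨ [m+kn]%n≡m%n r q n ⟨
    (r + q * n) % n    ≡⟨ cong (_% n) (trans (+-comm r (q * n)) (trans eq (+-comm (q′ * n) r′))) ⟩
    (r′ + q′ * n) % n  ≡⟨ [m+kn]%n≡m%n r′ q′ n ⟩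
    r′ % n             ≡⟨ m<n⇒m%n≡m r′<n ⟩
    r′                 ∎
  q≡q′ : q ≡ q′
  q≡q′ = *-cancelʳ-≡ q q′ n (+-cancelʳ-≡ r (q * n) (q′ * n) (trans eq (cong (q′ * n +_) (sym r≡r′))))

[m+[n+[o∸m]]%o]%o≡n%o : ∀ m n o .{{_ : NonZero o}} → m ≤ o → (m + (n + (o ∸ m)) % o) % o ≡ n % o
[m+[n+[o∸m]]%o]%o≡n%o m n o m≤o = begin
  (m + (n + (o ∸ m)) % o) % o             ≡⟨ %-distribˡ-+ m ((n + (o ∸ m)) % o) o ⟩
  (m % o + (n + (o ∸ m)) % o % o) % o     ≡⟨ cong (λ x → (m % o + x) % o) (m%n%n≡m%n (n + (o ∸ m)) o) ⟩
  (m % o + (n + (o ∸ m)) % o) % o         ≡⟨ %-distribˡ-+ m (n + (o ∸ m)) o ⟨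
  (m + (n + (o ∸ m))) % o                 ≡⟨ cong (_% o) m+[n+[o∸m]]≡n+o ⟩
  (n + o) % o                             ≡⟨ [m+n]%n≡m%n n o ⟩
  n % o                                   ∎
  where
  open ≡-Reasoning
  m+[n+[o∸m]]≡n+o : m + (n + (o ∸ m)) ≡ n + o
  m+[n+[o∸m]]≡n+o = trans (+-comm m (n + (o ∸ m)))
                      (trans (+-assoc n (o ∸ m) m) (cong (n +_) (trans (+-comm (o ∸ m) m) (m+[n∸m]≡n m≤o))))

[qn+r][n+1]%nn≡[q+r]%n*n+r : ∀ n q r .{{_ : NonZero n}} .{{_ : NonZero (n * n)}} → r < n →
                            (q * n + r) * (n + 1) % (n * n) ≡ (q + r) % n * n + r
[qn+r][n+1]%nn≡[q+r]%n*n+r n q r r<n = begin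
  (q * n + r) * (n + 1) % (n * n)               ≡⟨ cong (_% (n * n)) (expand q r n) ⟩
  ((q + r) * n + r + q * (n * n)) % (n * n)     ≡⟨ [m+kn]%n≡m%n ((q + r) * n + r) q (n * n) ⟩
  ((q + r) * n + r) % (n * n)                   ≡⟨ [m*n+o]%[p*n]≡[m*n]%[p*n]+o (q + r) n r<n ⟩
  (q + r) * n % (n * n) + r                     ≡⟨ cong (_+ r) (m%n*o≡m*o%[n*o] (q + r) n n) ⟨
  (q + r) % n * n + r                           ∎
  where
  open ≡-Reasoning
  expand : ∀ q r n → (q * n + r) * (n + 1) ≡ (q + r) * n + r + q * (n * n)
  expand = solve-∀

module Orbit {n} (π : Permutation′ n) where

  ^-+ : ∀ i j x → π ^[ i + j ] x ≡ π ^[ i ] (π ^[ j ] x)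
  ^-+ zero    j x = refl
  ^-+ (suc i) j x = cong (π ⟨$⟩ʳ_) (^-+ i j x)

  ^-injective : ∀ i {x y} → π ^[ i ] x ≡ π ^[ i ] y → x ≡ y
  ^-injective zero    eq = eq
  ^-injective (suc i) {x} {y} eq = ^-injective i (begin
    π ^[ i ] x               ≡⟨ inverseˡ π ⟨
    π ⟨$⟩ˡ (π ^[ suc i ] x)  ≡⟨ cong (π ⟨$⟩ˡ_) eq ⟩
    π ⟨$⟩ˡ (π ^[ suc i ] y)  ≡⟨ inverseˡ π ⟩
    π ^[ i ] y               ∎)
    where open ≡-Reasoning

  ^-*-period : ∀ d x → π ^[ d ] x ≡ x → ∀ c → π ^[ c * d ] x ≡ x
  ^-*-period d x πᵈx≡x zero    = refl
  ^-*-period d x πᵈx≡x (suc c) =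
    trans (^-+ d (c * d) x) (trans (cong (π ^[ d ]_) (^-*-period d x πᵈx≡x c)) πᵈx≡x)

  ^-%-period : ∀ d .{{_ : NonZero d}} x → π ^[ d ] x ≡ x → ∀ k → π ^[ k ] x ≡ π ^[ k % d ] x
  ^-%-period d x πᵈx≡x k = begin
    π ^[ k ] x                                ≡⟨ cong (λ e → π ^[ e ] x) (m≡m%n+[m/n]*n k d) ⟩
    π ^[ k % d + k / d * d ] x                ≡⟨ ^-+ (k % d) (k / d * d) x ⟩
    π ^[ k % d ] (π ^[ k / d * d ] x)         ≡⟨ cong (π ^[ k % d ]_) (^-*-period d x πᵈx≡x (k / d)) ⟩
    π ^[ k % d ] x                            ∎
    where open ≡-Reasoning

  ^-∸ : ∀ {i j} x → i ≤ j → π ^[ i ] x ≡ π ^[ j ] x → π ^[ j ∸ i ] x ≡ x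
  ^-∸ {i} {j} x i≤j eq = ^-injective i (begin
    π ^[ i ] (π ^[ j ∸ i ] x)  ≡⟨ ^-+ i (j ∸ i) x ⟨
    π ^[ i + (j ∸ i) ] x       ≡⟨ cong (λ e → π ^[ e ] x) (m+[n∸m]≡n i≤j) ⟩
    π ^[ j ] x                 ≡⟨ eq ⟨
    π ^[ i ] x                 ∎)
    where open ≡-Reasoning

  ^-return : ∀ x → ∃ λ d → 0 < d × d ≤ n × π ^[ d ] x ≡ x
  ^-return x with i , j , i<j , eq ← pigeonhole (n<1+n n) (λ (i : Fin (suc n)) → π ^[ toℕ i ] x) =
    toℕ j ∸ toℕ i , m<n⇒0<n∸m i<j , ≤-trans (m∸n≤m (toℕ j) (toℕ i)) (s≤s⁻¹ (toℕ<n j)) , ^-∸ x (<⇒≤ i<j) eq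

  module _ (cycle : IsSingleCycle π) where

    orbit-within : ∀ {d} .{{_ : NonZero d}} x → π ^[ d ] x ≡ x → ∀ y → ∃ λ k → k < d × π ^[ k ] x ≡ y
    orbit-within {d} x πᵈx≡x y with k , πᵏx≡y ← cycle x y =
      k % d , m%n<n k d , trans (sym (^-%-period d x πᵈx≡x k)) πᵏx≡y

    orbit-surjective : ∀ x y → ∃ λ k → k < n × π ^[ k ] x ≡ y
    orbit-surjective x y with d , 0<d , d≤n , πᵈx≡x ← ^-return x
      with k , k<d , πᵏx≡y ← orbit-within {{>-nonZero 0<d}} x πᵈx≡x y = k , <-≤-trans k<d d≤n , πᵏx≡y

    -- A return time d lets k ↦ k mod d encode the n points of the orbit injectively in Fin d.
    period-≥ : ∀ {d} .{{_ : NonZero d}} x → π ^[ d ] x ≡ x → n ≤ d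
    period-≥ {d} x πᵈx≡x = injective⇒≤ encode-injective
      where
      index<d : ∀ y → proj₁ (orbit-within x πᵈx≡x y) < d
      index<d y = proj₁ (proj₂ (orbit-within x πᵈx≡x y))
      encode : Fin n → Fin d
      encode y = fromℕ< (index<d y)
      decode : ∀ y → π ^[ toℕ (encode y) ] x ≡ y
      decode y = trans (cong (λ e → π ^[ e ] x) (toℕ-fromℕ< (index<d y))) (proj₂ (proj₂ (orbit-within x πᵈx≡x y)))
      encode-injective : Injective _≡_ _≡_ encode
      encode-injective {y} {z} eq = trans (sym (decode y)) (trans (cong (λ e → π ^[ toℕ e ] x) eq) (decode z))

    no-early-return : ∀ x {i j} → i < j → j < n → π ^[ i ] x ≢ π ^[ j ] x
    no-early-return x {i} {j} i<j j<n eq =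
      <⇒≱ (≤-<-trans (m∸n≤m j i) j<n) (period-≥ {{>-nonZero (m<n⇒0<n∸m i<j)}} x (^-∸ x (<⇒≤ i<j) eq))

    orbit-injective : ∀ x {i j} → i < n → j < n → π ^[ i ] x ≡ π ^[ j ] x → i ≡ j
    orbit-injective x {i} {j} i<n j<n eq with <-cmp i j
    ... | tri< i<j _ _ = contradiction eq (no-early-return x i<j j<n)
    ... | tri≈ _ i≡j _ = i≡j
    ... | tri> _ _ j<i = contradiction (sym eq) (no-early-return x j<i i<n)

applyUpTo-cong : ∀ {A : Set} {f g : ℕ → A} → f ≗ g → ∀ n → applyUpTo f n ≡ applyUpTo g n
applyUpTo-cong f≗g zero    = refl
applyUpTo-cong f≗g (suc n) = cong₂ _∷_ (f≗g 0) (applyUpTo-cong (f≗g ∘ suc) n)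

applyUpTo-+ : ∀ {A : Set} (f : ℕ → A) m n → applyUpTo f (m + n) ≡ applyUpTo f m ++ applyUpTo (λ i → f (m + i)) n
applyUpTo-+ f zero    n = refl
applyUpTo-+ f (suc m) n = cong (f 0 ∷_) (applyUpTo-+ (f ∘ suc) m n)

zip-tabulate : ∀ {A B : Set} {m} (f : Fin m → A) (g : Fin m → B) →
               zip (tabulate f) (tabulate g) ≡ tabulate (λ i → f i , g i)
zip-tabulate {m = zero}  f g = refl
zip-tabulate {m = suc m} f g = cong (_ ∷_) (zip-tabulate (f ∘ suc) (g ∘ suc))

Diagonal : {A : Set} → A × A → Set
Diagonal (x , y) = x ≡ y

data DiagonalInsertion {A : Set} : List (A × A) → List (A × A) → Set where
  []     : DiagonalInsertion [] []
  keep   : ∀ {z ws zs} → DiagonalInsertion ws zs → DiagonalInsertion (z ∷ ws) (z ∷ zs)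
  insert : ∀ {z ws zs} → Diagonal z → DiagonalInsertion ws zs → DiagonalInsertion ws (z ∷ zs)

module _ {A : Set} where

  interleave-∷ : ∀ {m} (x : A) x₀ (xs : Vec (List A) m) w →
                 interleave ((x ∷ x₀) ∷ xs) w ≡ x ∷ interleave (x₀ ∷ xs) w
  interleave-∷ x x₀ []       []      = refl
  interleave-∷ x x₀ (_ ∷ _)  (_ ∷ _) = refl

  diagonalInsertion⇒simultaneousInsertion :
    ∀ {m} (w₁ w₂ : Vec A m) {zs} → DiagonalInsertion (toList (zip w₁ w₂)) zs →
    SimultaneousInsertion w₁ w₂ (map proj₁ zs) (map proj₂ zs)
  diagonalInsertion⇒simultaneousInsertion (a ∷ w₁) (b ∷ w₂) (keep d)
    with x ∷ xs , eq₁ , eq₂ ← diagonalInsertion⇒simultaneousInsertion w₁ w₂ d =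
    [] ∷ x ∷ xs , cong (a ∷_) eq₁ , cong (b ∷_) eq₂
  diagonalInsertion⇒simultaneousInsertion []        []        []        = [] ∷ [] , refl , refl
  diagonalInsertion⇒simultaneousInsertion w₁ w₂ (insert {x , _} refl d)
    with x₀ ∷ xs , eq₁ , eq₂ ← diagonalInsertion⇒simultaneousInsertion w₁ w₂ d =
    (x ∷ x₀) ∷ xs , trans (cong (x ∷_) eq₁) (sym (interleave-∷ x x₀ xs w₁))
                  , trans (cong (x ∷_) eq₂) (sym (interleave-∷ x x₀ xs w₂))

  diagonalInsertion-++ : ∀ {ws zs ws′ zs′ : List (A × A)} → DiagonalInsertion ws zs → DiagonalInsertion ws′ zs′ →
                         DiagonalInsertion (ws ++ ws′) (zs ++ zs′)
  diagonalInsertion-++ []           d′ = d′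
  diagonalInsertion-++ (keep d)     d′ = keep (diagonalInsertion-++ d d′)
  diagonalInsertion-++ (insert z d) d′ = insert z (diagonalInsertion-++ d d′)

  diagonalInsertion-[] : ∀ (P : ℕ → A × A) n → (∀ r → r < n → Diagonal (P r)) → DiagonalInsertion [] (applyUpTo P n)
  diagonalInsertion-[] P zero    _        = []
  diagonalInsertion-[] P (suc n) diagonal =
    insert (diagonal 0 z<s) (diagonalInsertion-[] (P ∘ suc) n (λ r r<n → diagonal (suc r) (s<s r<n)))

  diagonalInsertion-singleton : ∀ (P : ℕ → A × A) {s n} → s < n → (∀ r → r < n → r ≢ s → Diagonal (P r)) →
                                DiagonalInsertion [ P s ] (applyUpTo P n)
  diagonalInsertion-singleton P {zero}  {suc n} z<s       diagonal =
    keep (diagonalInsertion-[] (P ∘ suc) n (λ r r<n → diagonal (suc r) (s<s r<n) λ ()))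
  diagonalInsertion-singleton P {suc s} {suc n} (s<s s<n) diagonal =
    insert (diagonal 0 z<s λ ())
      (diagonalInsertion-singleton (P ∘ suc) s<n (λ r r<n r≢s → diagonal (suc r) (s<s r<n) (r≢s ∘ suc-injective)))

  diagonalInsertion-blocks : ∀ {m} n (h : Fin m → A × A) (P : ℕ → A × A) →
    (∀ t → DiagonalInsertion [ h t ] (applyUpTo (λ r → P (toℕ t * n + r)) n)) →
    DiagonalInsertion (toList (tabulate h)) (applyUpTo P (m * n))
  diagonalInsertion-blocks {zero}  n h P blocks = []
  diagonalInsertion-blocks {suc m} n h P blocks =
    subst (DiagonalInsertion (toList (tabulate h))) (sym (applyUpTo-+ P n (m * n)))
      (diagonalInsertion-++ (blocks zero)
        (diagonalInsertion-blocks n (h ∘ suc) (λ i → P (n + i)) shifted))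
    where
    shifted : ∀ t → DiagonalInsertion [ h (suc t) ] (applyUpTo (λ r → P (n + (toℕ t * n + r))) n)
    shifted t = subst (DiagonalInsertion [ h (suc t) ])
                  (applyUpTo-cong (λ r → cong P (+-assoc n (toℕ t * n) r)) n) (blocks (suc t))

module Layout (n : ℕ) .{{_ : NonZero n}} (π : Permutation′ n) (cycle : IsSingleCycle π) where
  open Construction n π
  open Orbit π

  -- (t − k) mod n, as written in f; adding n avoids truncated subtraction.
  infix 8 _⊖_
  _⊖_ : ℕ → ℕ → ℕ
  t ⊖ k = (t + (n ∸ k)) % n

  +⊖-cancel : ∀ {t k} → t < n → k ≤ n → (k + t ⊖ k) % n ≡ t
  +⊖-cancel {t} {k} t<n k≤n = trans ([m+[n+[o∸m]]%o]%o≡n%o k t n k≤n) (m<n⇒m%n≡m t<n)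

  φ-digits : ∀ q {r} → r < n → φ (q * n + r) ≡ (q + r) % n * n + r
  φ-digits q {r} r<n = [qn+r][n+1]%nn≡[q+r]%n*n+r n q r r<n

  f-digits : ∀ {t k} → t < n → k < n → f t k ≡ t * n + t ⊖ k
  f-digits {t} {k} t<n k<n =
    trans (φ-digits k (m%n<n _ n)) (cong (λ x → x * n + t ⊖ k) (+⊖-cancel t<n (<⇒≤ k<n)))

  φ-surjective : ∀ {t r} → t < n → r < n → φ ((t ⊖ r) * n + r) ≡ t * n + r
  φ-surjective {t} {r} t<n r<n =
    trans (φ-digits (t ⊖ r) r<n)
          (cong (λ x → x * n + r) (trans (cong (_% n) (+-comm (t ⊖ r) r)) (+⊖-cancel t<n (<⇒≤ r<n))))

  φ∘φ⁻¹ : ∀ {t r} → t < n → r < n → φ (φ⁻¹ (t * n + r)) ≡ t * n + r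
  φ∘φ⁻¹ {t} {r} t<n r<n with search φ (t * n + r) (n * n) in found
  ... | just _  = proj₁ (search-sound φ (t * n + r) (n * n) found)
  ... | nothing = contradiction (φ-surjective t<n r<n)
                    (search-complete φ (t * n + r) (n * n) found _ (digits-< (m%n<n _ n) r<n))

  orbitIndex : Fin n → ℕ
  orbitIndex t = proj₁ (orbit-surjective cycle (0F n) t)

  orbitIndex<n : ∀ t → orbitIndex t < n
  orbitIndex<n t = proj₁ (proj₂ (orbit-surjective cycle (0F n) t))

  orb-orbitIndex : ∀ t → orb (orbitIndex t) ≡ t
  orb-orbitIndex t = proj₂ (proj₂ (orbit-surjective cycle (0F n) t))

  column : Fin n → ℕ
  column t = toℕ t ⊖ orbitIndex t

  column<n : ∀ t → column t < n
  column<n t = m%n<n _ n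

  distinguished : ℕ → ℕ
  distinguished k = f (toℕ (orb k)) k

  distinguished-orbitIndex : ∀ t → distinguished (orbitIndex t) ≡ toℕ t * n + column t
  distinguished-orbitIndex t =
    trans (cong (λ s → f (toℕ s) (orbitIndex t)) (orb-orbitIndex t)) (f-digits (toℕ<n t) (orbitIndex<n t))

  distK-just : ∀ t {r k} → r < n → distK (toℕ t * n + r) ≡ just k → orb k ≡ t × r ≡ column t
  distK-just t {r} {k} r<n found = orbk≡t , r≡column
    where
    hit : distinguished k ≡ toℕ t * n + r × k < n
    hit = search-sound distinguished (toℕ t * n + r) n found
    digits : toℕ (orb k) ≡ toℕ t × toℕ (orb k) ⊖ k ≡ r
    digits = digits-injective (m%n<n _ n) r<n (trans (sym (f-digits (toℕ<n (orb k)) (proj₂ hit))) (proj₁ hit))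
    orbk≡t : orb k ≡ t
    orbk≡t = toℕ-injective (proj₁ digits)
    k≡orbitIndex : k ≡ orbitIndex t
    k≡orbitIndex = orbit-injective cycle (0F n) (proj₂ hit) (orbitIndex<n t) (trans orbk≡t (sym (orb-orbitIndex t)))
    r≡column : r ≡ column t
    r≡column = trans (sym (proj₂ digits)) (cong₂ _⊖_ (proj₁ digits) k≡orbitIndex)

  distK-column : ∀ t → distK (toℕ t * n + column t) ≢ nothing
  distK-column t none =
    search-complete distinguished _ n none (orbitIndex t) (orbitIndex<n t) (distinguished-orbitIndex t)

  a-just : ∀ i {k} → distK (φ i) ≡ just k → a i ≡ orb k
  a-just i found rewrite found = refl

  b-just : ∀ i {k} → distK (φ i) ≡ just k → b i ≡ orb (suc k)
  b-just zero    found rewrite found = refl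
  b-just (suc i) found rewrite found = refl

  a-nothing : ∀ i → distK (φ i) ≡ nothing → a i ≡ b (i ∸ 1)
  a-nothing i none rewrite none = refl

  b-nothing : ∀ i → distK (φ i) ≡ nothing → b i ≡ b (i ∸ 1)
  b-nothing zero    none = refl
  b-nothing (suc i) none rewrite none = refl

  a≡b-nothing : ∀ i → distK (φ i) ≡ nothing → a i ≡ b i
  a≡b-nothing i none = trans (a-nothing i none) (sym (b-nothing i none))

  letters : ℕ → Fin n × Fin n
  letters q = a (φ⁻¹ q) , b (φ⁻¹ q)

  letters-column : ∀ t → letters (toℕ t * n + column t) ≡ (t , π ⟨$⟩ʳ t)
  letters-column t with distK (toℕ t * n + column t) in found
  ... | nothing = contradiction found (distK-column t)
  ... | just k  = cong₂ _,_ (trans (a-just i found′) orbk≡t) (trans (b-just i found′) (cong (π ⟨$⟩ʳ_) orbk≡t))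
    where
    i : ℕ
    i = φ⁻¹ (toℕ t * n + column t)
    found′ : distK (φ i) ≡ just k
    found′ = trans (cong distK (φ∘φ⁻¹ (toℕ<n t) (column<n t))) found
    orbk≡t : orb k ≡ t
    orbk≡t = proj₁ (distK-just t (column<n t) found)

  letters-off-column : ∀ t {r} → r < n → r ≢ column t → Diagonal (letters (toℕ t * n + r))
  letters-off-column t {r} r<n r≢column with distK (toℕ t * n + r) in found
  ... | just _  = contradiction (proj₂ (distK-just t r<n found)) r≢column
  ... | nothing = a≡b-nothing (φ⁻¹ (toℕ t * n + r)) (trans (cong distK (φ∘φ⁻¹ (toℕ<n t) r<n)) found)

  letters-diagonalInsertion :
    DiagonalInsertion (toList (tabulate (λ t → t , π ⟨$⟩ʳ t))) (applyUpTo letters (n * n))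
  letters-diagonalInsertion = diagonalInsertion-blocks n _ letters λ t →
    let block = λ r → letters (toℕ t * n + r) in
    subst (λ z → DiagonalInsertion [ z ] (applyUpTo block n)) (letters-column t)
      (diagonalInsertion-singleton block (column<n t) (λ r r<n → letters-off-column t r<n))

  u′≡map-proj₁-letters : u′ ≡ map proj₁ (applyUpTo letters (n * n))
  u′≡map-proj₁-letters = trans (map-upTo _ (n * n)) (sym (map-applyUpTo letters proj₁ (n * n)))

  v′≡map-proj₂-letters : v′ ≡ map proj₂ (applyUpTo letters (n * n))
  v′≡map-proj₂-letters = trans (map-upTo _ (n * n)) (sym (map-applyUpTo letters proj₂ (n * n)))

lemma6 : (n : ℕ) .{{_ : NonZero n}} (π : Permutation′ n) → IsSingleCycle π →
    SimultaneousInsertion (Construction.u n π) (Construction.v n π) (Construction.u′ n π) (Construction.v′ n π)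
lemma6 n π cycle =
  subst₂ (SimultaneousInsertion u v) (sym u′≡map-proj₁-letters) (sym v′≡map-proj₂-letters)
    (diagonalInsertion⇒simultaneousInsertion u v
      (subst (λ ws → DiagonalInsertion ws (applyUpTo letters (n * n)))
             (cong toList (sym (zip-tabulate _ _))) letters-diagonalInsertion))
  where
  open Construction n π
  open Layout n π cycle
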